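{- The continuous bar induction ${\rm c\text{ -- }BI}$ is equivalent to the principle of Brouwer continuity ${\rm BC}$: each implies the other.
   Context: Work in Bishop-style constructive mathematics (no excluded middle), with countable choice $(\forall x\in\mathbb{N})(\exists\alpha\in\mathbb{N}^{\mathbb{N}})A(x,\alpha)\to(\exists F)(\forall x)A(x,F(x))$ and unique choice for functions $\mathbb{N}^{\mathbb{N}}\to\mathbb{N}$ (for decidable relations). Notation: $\mathbb{N}^*$ finite sequences of naturals, $a*b$ concatenation (also of a finite with an infinite sequence), $\langle\rangle$ empty sequence, $\langle n\rangle$ one-element sequence, $\overline{\alpha}n$ initial segment of length $n$, $|a|$ length, $0^\omega=\lambda x.0$. A predicate $P\subseteq\mathbb{N}^*$ is a bar if $(\forall\alpha\in\mathbb{N}^{\mathbb{N}})(\exists n)P(\overline{\alpha}n)$; a c--bar is a bar $P$ for which there is $\delta\colon\mathbb{N}^*\to\mathbb{N}$ with $P(a)\leftrightarrow(\forall b\in\mathbb{N}^*)\delta(a)=\delta(a*b)$ for all $a$. $Q\subseteq\mathbb{N}^*$ is inductive if $(\forall a)[(\forall n)Q(a*\langle n\rangle)\to Q(a)]$. ${\rm c\text{ -- }BI}$: for every c--bar $P$ and every predicate $Q\subseteq\mathbb{N}^*$, if $P\subseteq Q$ and $Q$ is inductive then $Q(\langle\rangle)$. The class $K$ of Brouwer-operations is the predicate on $\mathbb{N}^{\mathbb{N}^*}$ inductively defined (least class, with induction principle) by: (i) $\lambda a.\,n+1\in K$ for each $n$; (ii) if $\gamma(\langle\rangle)=0$ and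 $\lambda a.\,\gamma(\langle n\rangle*a)\in K$ for every $n$, then $\gamma\in K$. For $\gamma\in K$, $F_\gamma\colon\mathbb{N}^{\mathbb{N}}\to\mathbb{N}$ is $F_\gamma(\alpha)=\gamma(\overline{\alpha}m)-1$ with $m$ the least $z$ such that $\gamma(\overline{\alpha}z)>0$. $F$ is $K$-realisable if $F=F_\gamma$ for some $\gamma\in K$. $F\colon\mathbb{N}^{\mathbb{N}}\to\mathbb{N}$ is pointwise continuous if $(\forall\alpha)(\exists n)(\forall\beta)[\overline{\beta}n=\overline{\alpha}n\to F(\beta)=F(\alpha)]$. ${\rm BC}$: every pointwise continuous $F\colon\mathbb{N}^{\mathbb{N}}\to\mathbb{N}$ is $K$-realisable. -}

module Defs where

open import Data.Nat using (ℕ; zero; suc; _∸_; _<_; _>_)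
open import Data.List using (List; []; _∷_; _++_; [_])
open import Data.Product using (Σ; ∃; _×_; _,_)
open import Relation.Binary.PropositionalEquality using (_≡_)
open import Function.Bundles using (_⇔_)

Baire : Set
Baire = ℕ → ℕ

initial : Baire → ℕ → List ℕ
initial α zero    = []
initial α (suc n) = initial α n ++ [ α n ]

IsBar : (List ℕ → Set) → Set
IsBar P = (α : Baire) → ∃ λ n → P (initial α n)

IsCBar : (List ℕ → Set) → Set
IsCBar P = IsBar P × Σ (List ℕ → ℕ) (λ δ →
             (a : List ℕ) → P a ⇔ ((b : List ℕ) → δ a ≡ δ (a ++ b)))

Inductive : (List ℕ → Set) → Set
Inductive Q = (a : List ℕ) → ((n : ℕ) → Q (a ++ [ n ])) → Q a

cBI : Set₁
cBI = (P Q : List ℕ → Set) → IsCBar P → ((a : List ℕ) → P a → Q a)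
      → Inductive Q → Q []

-- the inductively defined class K of Brouwer operations
-- (clause (i) stated extensionally: γ is pointwise λa. n+1)
data K : (List ℕ → ℕ) → Set where
  K-const : (γ : List ℕ → ℕ) (n : ℕ) → ((a : List ℕ) → γ a ≡ suc n) → K γ
  K-step  : (γ : List ℕ → ℕ) → γ [] ≡ 0
          → ((n : ℕ) → K (λ a → γ (n ∷ a))) → K γ

-- F = F_γ, unfolded: for each α, with m the least z such that γ(ᾱz) > 0,
-- F(α) = γ(ᾱm) - 1
Realises : (List ℕ → ℕ) → (Baire → ℕ) → Set
Realises γ F = (α : Baire) → ∃ λ m →
  (γ (initial α m) > 0)
  × ((z : ℕ) → z < m → γ (initial α z) ≡ 0)
  × (F α ≡ γ (initial α m) ∸ 1)

KRealisable : (Baire → ℕ) → Set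
KRealisable F = ∃ λ γ → K γ × Realises γ F

PointwiseContinuous : (Baire → ℕ) → Set
PointwiseContinuous F = (α : Baire) → ∃ λ n →
  (β : Baire) → initial β n ≡ initial α n → F β ≡ F α

BC : Set
BC = (F : Baire → ℕ) → PointwiseContinuous F → KRealisable F

module Submission where

-- cBI ⇒ BC.  For a pointwise continuous F put δ(a) = F(a*0^ω).  The nodes a on
-- whose extensions δ is constant form a c-bar (witnessed by δ itself, a bar by
-- continuity), and at each of them F(a*–) is constant, hence K-realisable.  K-
-- realisability of F(a*–) is an inductive property of a, since realisers of
-- the branches F(a*⟨n⟩*–) glue to a realiser of F(a*–).  So c-BI gives it at ⟨⟩.
--
-- BC ⇒ cBI.  For a c-bar P with witness δ, δ(ᾱk) is constant in k ≥ N(α), the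
-- bar index of α.  The point from which it settles, F(α) = settle (δ ∘ ᾱ) N(α),
-- is pointwise continuous, so BC yields a Brouwer operation γ realising it.
-- Wherever γ fires, F is constant below that node, so P holds on all long
-- enough extensions of it, and an inductive Q ⊇ P holds there.  Induction over
-- the well-founded tree γ ∈ K then carries Q down to the root.

open import Defs
open import Function.Bundles using (_⇔_; mk⇔; Equivalence)
open import Data.Nat using (ℕ; zero; suc; _+_; _∸_; _<_; _>_; _≤_; z≤n; s≤s; s≤s⁻¹; _≟_; _≤?_)
open import Data.Nat.Properties
  using (≤-refl; ≤-trans; ≤-antisym; <⇒≤; <⇒≱; >⇒≢; ≰⇒>; m≤n⇒m<n∨m≡n; m≤m+n; m≤n+m; n≤1+n; m≤n⇒m≤1+n; +-comm)
open import Data.List using (List; []; _∷_; _++_; [_]; length)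
open import Data.List.Properties using (∷-injective; ++-assoc; ++-identityʳ; length-++)
open import Data.Product using (∃; _×_; _,_; proj₁; proj₂)
open import Data.Sum using (inj₁; inj₂)
open import Data.Empty using (⊥-elim)
open import Relation.Nullary using (yes; no)
open import Relation.Binary.PropositionalEquality using (_≡_; refl; sym; trans; cong; cong₂; subst; module ≡-Reasoning)

cons : ℕ → Baire → Baire
cons x β zero    = x
cons x β (suc k) = β k

tail : Baire → Baire
tail α k = α (suc k)

0ω : Baire
0ω _ = 0

infixr 5 _++ₛ_
_++ₛ_ : List ℕ → Baire → Baire
[]      ++ₛ β = β
(x ∷ l) ++ₛ β = cons x (l ++ₛ β)

Through : Baire → List ℕ → Set
Through α l = initial α (length l) ≡ l

length-≤-++ˡ : ∀ (a b : List ℕ) → length a ≤ length (a ++ b)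
length-≤-++ˡ a b = subst (length a ≤_) (sym (length-++ a)) (m≤m+n (length a) (length b))

length-≤-++ʳ : ∀ (a b : List ℕ) → length b ≤ length (a ++ b)
length-≤-++ʳ a b = subst (length b ≤_) (sym (length-++ a)) (m≤n+m (length b) (length a))

length-initial : ∀ α n → length (initial α n) ≡ n
length-initial α zero    = refl
length-initial α (suc n) = trans (length-++ (initial α n)) (trans (cong (_+ 1) (length-initial α n)) (+-comm n 1))

through-initial : ∀ α β n → Through β (initial α n) → initial β n ≡ initial α n
through-initial α β n = subst (λ m → initial β m ≡ initial α n) (length-initial α n)

initial-through : ∀ α β n → initial β n ≡ initial α n → Through β (initial α n)
initial-through α β n = subst (λ m → initial β m ≡ initial α n) (sym (length-initial α n))

initial-suc : ∀ α m → initial α (suc m) ≡ α 0 ∷ initial (tail α) m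
initial-suc α zero    = refl
initial-suc α (suc m) = cong (_++ [ α (suc m) ]) (initial-suc α m)

initial-++ₛ : ∀ l β j → initial (l ++ₛ β) (length l + j) ≡ l ++ initial β j
initial-++ₛ []      β j = refl
initial-++ₛ (x ∷ l) β j = trans (initial-suc ((x ∷ l) ++ₛ β) (length l + j)) (cong (x ∷_) (initial-++ₛ l β j))

through-++ₛ : ∀ l β → Through (l ++ₛ β) l
through-++ₛ []      β = refl
through-++ₛ (x ∷ l) β = trans (initial-suc ((x ∷ l) ++ₛ β) (length l)) (cong (x ∷_) (through-++ₛ l β))

through-++ₛ-initial : ∀ a α n → Through (a ++ₛ α) (a ++ initial α n)
through-++ₛ-initial a α n =
  subst (λ m → initial (a ++ₛ α) m ≡ a ++ initial α n)
        (sym (trans (length-++ a) (cong (length a +_) (length-initial α n))))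
        (initial-++ₛ a α n)

through-prefix : ∀ α a b → Through α (a ++ b) → Through α a
through-prefix α []      b t = refl
through-prefix α (x ∷ a) b t =
  trans (initial-suc α (length a))
        (cong₂ _∷_ (proj₁ heads) (through-prefix (tail α) a b (proj₂ heads)))
  where
    heads : α 0 ≡ x × Through (tail α) (a ++ b)
    heads = ∷-injective (trans (sym (initial-suc α (length (a ++ b)))) t)

initial-extends : ∀ α {k} n → k ≤ n → ∃ λ b → initial α n ≡ initial α k ++ b
initial-extends α zero    z≤n = [] , refl
initial-extends α (suc n) k≤1+n with m≤n⇒m<n∨m≡n k≤1+n
... | inj₂ refl = [] , sym (++-identityʳ _)
... | inj₁ k<1+n with initial-extends α n (s≤s⁻¹ k<1+n)
...   | b , e = b ++ [ α n ] , trans (cong (_++ [ α n ]) e) (++-assoc _ b [ α n ])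

initial-shorter : ∀ α β {k n} → k ≤ n → initial α n ≡ initial β n → initial α k ≡ initial β k
initial-shorter α β {k} {n} k≤n e with initial-extends β n k≤n
... | b , βn≡ = through-initial β α k
                  (through-prefix α (initial β k) b
                     (subst (Through α) βn≡ (initial-through β α n e)))

settle : (ℕ → ℕ) → ℕ → ℕ
settle f zero = zero
settle f (suc N) with f N ≟ f (suc N)
... | yes _ = settle f N
... | no  _ = suc N

settle-constant : ∀ f N k → settle f N ≤ k → k ≤ N → f k ≡ f N
settle-constant f zero    .zero z≤n z≤n = refl
settle-constant f (suc N) k s≤k k≤1+N with f N ≟ f (suc N) | m≤n⇒m<n∨m≡n k≤1+N
... | _        | inj₂ refl  = refl
... | yes fN≡  | inj₁ k<1+N = trans (settle-constant f N k s≤k (s≤s⁻¹ k<1+N)) fN≡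
... | no  _    | inj₁ k<1+N = ⊥-elim (<⇒≱ k<1+N s≤k)

settle-step : ∀ f N → f N ≡ f (suc N) → settle f (suc N) ≡ settle f N
settle-step f N e with f N ≟ f (suc N)
... | yes _  = refl
... | no  ne = ⊥-elim (ne e)

settle-local : ∀ f g N → (∀ k → k ≤ N → f k ≡ g k) → settle f N ≡ settle g N
settle-local f g zero    f≗g = refl
settle-local f g (suc N) f≗g with f N ≟ f (suc N) | g N ≟ g (suc N)
... | yes _  | yes _  = settle-local f g N (λ k k≤N → f≗g k (m≤n⇒m≤1+n k≤N))
... | no  _  | no  _  = refl
... | yes e  | no  ne = ⊥-elim (ne (trans (sym (f≗g N (n≤1+n N))) (trans e (f≗g (suc N) ≤-refl))))
... | no  ne | yes e  = ⊥-elim (ne (trans (f≗g N (n≤1+n N)) (trans e (sym (f≗g (suc N) ≤-refl)))))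

Stable : (ℕ → ℕ) → ℕ → Set
Stable f N = ∀ k → N ≤ k → f k ≡ f N

settle-modulus : ∀ f N → Stable f N → ∀ k → settle f N ≤ k → f k ≡ f N
settle-modulus f N st k s≤k with N ≤? k
... | yes N≤k = st k N≤k
... | no  N≰k = settle-constant f N k s≤k (<⇒≤ (≰⇒> N≰k))

settle-frozen : ∀ f N → Stable f N → ∀ j → settle f (j + N) ≡ settle f N
settle-frozen f N st zero    = refl
settle-frozen f N st (suc j) = trans (settle-step f (j + N) step) (settle-frozen f N st j)
  where
    step : f (j + N) ≡ f (suc j + N)
    step = trans (st (j + N) (m≤n+m N j)) (sym (st (suc j + N) (m≤n+m N (suc j))))

settle-unique : ∀ f N M → Stable f N → Stable f M → settle f N ≡ settle f M
settle-unique f N M stN stM =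
  trans (sym (settle-frozen f N stN M))
        (trans (cong (settle f) (+-comm M N)) (settle-frozen f M stM N))

FirstPositive : (List ℕ → ℕ) → Baire → ℕ → Set
FirstPositive γ α m = γ (initial α m) > 0 × ((z : ℕ) → z < m → γ (initial α z) ≡ 0)

first-positive-≤ : ∀ γ α m L → FirstPositive γ α m → γ (initial α L) > 0 → m ≤ L
first-positive-≤ γ α m L (_ , zeros) pos with m ≤? L
... | yes m≤L = m≤L
... | no  m≰L = ⊥-elim (>⇒≢ pos (zeros L (≰⇒> m≰L)))

first-positive-unique : ∀ γ α m m′ → FirstPositive γ α m → FirstPositive γ α m′ → m ≡ m′
first-positive-unique γ α m m′ fp fp′ =
  ≤-antisym (first-positive-≤ γ α m m′ fp (proj₁ fp′)) (first-positive-≤ γ α m′ m fp′ (proj₁ fp))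

first-positive-transfer : ∀ γ α β m L → initial α L ≡ initial β L → m ≤ L
                        → FirstPositive γ β m → FirstPositive γ α m
first-positive-transfer γ α β m L agree m≤L (pos , zeros) =
  subst (λ l → γ l > 0) (sym (agree-below m≤L)) pos ,
  λ z z<m → trans (cong γ (agree-below (≤-trans (<⇒≤ z<m) m≤L))) (zeros z z<m)
  where
    agree-below : ∀ {k} → k ≤ L → initial α k ≡ initial β k
    agree-below k≤L = initial-shorter α β k≤L agree

realised-constant : ∀ γ G → Realises γ G → ∀ α β L → γ (initial α L) > 0
                  → initial α L ≡ initial β L → G α ≡ G β
realised-constant γ G real α β L pos agree with real α | real β
... | m , posα , zerosα , Gα | m′ , posβ , zerosβ , Gβ = begin
  G α                        ≡⟨ Gα ⟩
  γ (initial α m) ∸ 1        ≡⟨ cong (λ l → γ l ∸ 1) (initial-shorter α β m≤L agree) ⟩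
  γ (initial β m) ∸ 1        ≡⟨ cong (λ k → γ (initial β k) ∸ 1) m≡m′ ⟩
  γ (initial β m′) ∸ 1       ≡⟨ sym Gβ ⟩
  G β                        ∎
  where
    open ≡-Reasoning
    m≤L : m ≤ L
    m≤L = first-positive-≤ γ α m L (posα , zerosα) pos
    m′≤L : m′ ≤ L
    m′≤L = first-positive-≤ γ β m′ L (posβ , zerosβ) (subst (λ l → γ l > 0) agree pos)
    m≡m′ : m ≡ m′
    m≡m′ = first-positive-unique γ α m m′ (posα , zerosα)
             (first-positive-transfer γ α β m′ L agree m′≤L (posβ , zerosβ))

realised-constant-below : ∀ γ G → Realises γ G → ∀ c → γ c > 0
                        → ∀ α β → Through α c → Through β c → G α ≡ G β
realised-constant-below γ G real c pos α β tα tβ =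
  realised-constant γ G real α β (length c) (subst (λ l → γ l > 0) (sym tα) pos) (trans tα (sym tβ))

realisable-ext : ∀ G H → (∀ α → G α ≡ H α) → KRealisable G → KRealisable H
realisable-ext G H G≗H (γ , γ∈K , real) = γ , γ∈K , realH
  where
    realH : Realises γ H
    realH α with real α
    ... | m , pos , zeros , Gα = m , pos , zeros , trans (sym (G≗H α)) Gα

realisable-const : ∀ n → KRealisable (λ _ → n)
realisable-const n = (λ _ → suc n) , K-const _ n (λ _ → refl) , λ α → 0 , s≤s z≤n , (λ z ()) , refl

realisable-cases : ∀ (G : ℕ → Baire → ℕ) → (∀ n → KRealisable (G n))
                 → KRealisable (λ α → G (α 0) (tail α))
realisable-cases G r = γ , K-step γ refl (λ n → proj₁ (proj₂ (r n))) , real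
  where
    γ : List ℕ → ℕ
    γ []      = 0
    γ (n ∷ l) = proj₁ (r n) l
    real : Realises γ (λ α → G (α 0) (tail α))
    real α with proj₂ (proj₂ (r (α 0))) (tail α)
    ... | m , pos , zeros , Gα =
      suc m , subst (λ l → γ l > 0) (sym (initial-suc α m)) pos , zeros′ ,
      trans Gα (cong (λ l → γ l ∸ 1) (sym (initial-suc α m)))
      where
        zeros′ : (z : ℕ) → z < suc m → γ (initial α z) ≡ 0
        zeros′ zero    _   = refl
        zeros′ (suc z) z<m = trans (cong γ (initial-suc α z)) (zeros z (s≤s⁻¹ z<m))

inductive-below : ∀ (Q : List ℕ → Set) → Inductive Q → ∀ c → Inductive (λ a → Q (c ++ a))
inductive-below Q Q-ind c a ih = Q-ind (c ++ a) (λ n → subst Q (sym (++-assoc c a [ n ])) (ih n))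

inductive-eventually : ∀ (P Q : List ℕ → Set) → (∀ a → P a → Q a) → Inductive Q
                     → ∀ k → (∀ b → k ≤ length b → P b) → Q []
inductive-eventually P Q P⊆Q Q-ind zero    long = P⊆Q [] (long [] z≤n)
inductive-eventually P Q P⊆Q Q-ind (suc k) long = Q-ind [] λ n →
  inductive-eventually (λ b → P (n ∷ b)) (λ b → Q (n ∷ b)) (λ b → P⊆Q (n ∷ b))
    (inductive-below Q Q-ind [ n ]) k (λ b k≤b → long (n ∷ b) (s≤s k≤b))

K-induction : ∀ (Q : List ℕ → Set) → Inductive Q → ∀ {γ} → K γ → (∀ c → γ c > 0 → Q c) → Q []
K-induction Q Q-ind (K-const γ n γ≡) fires = fires [] (subst (_> 0) (sym (γ≡ [])) (s≤s z≤n))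
K-induction Q Q-ind (K-step γ _ subtrees) fires = Q-ind [] λ n →
  K-induction (λ a → Q (n ∷ a)) (inductive-below Q Q-ind [ n ]) (subtrees n) (λ c → fires (n ∷ c))

initial-pointwise : ∀ α β → (∀ k → α k ≡ β k) → ∀ n → initial α n ≡ initial β n
initial-pointwise α β α≗β zero    = refl
initial-pointwise α β α≗β (suc n) = cong₂ _++_ (initial-pointwise α β α≗β n) (cong [_] (α≗β n))

continuous-ext : ∀ F → PointwiseContinuous F → ∀ α β → (∀ k → α k ≡ β k) → F α ≡ F β
continuous-ext F F-cont α β α≗β with F-cont β
... | n , near = near α (initial-pointwise α β α≗β n)

++ₛ-shift : ∀ a α k → ((a ++ [ α 0 ]) ++ₛ tail α) k ≡ (a ++ₛ α) k
++ₛ-shift []      α zero    = refl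
++ₛ-shift []      α (suc k) = refl
++ₛ-shift (x ∷ a) α zero    = refl
++ₛ-shift (x ∷ a) α (suc k) = ++ₛ-shift a α k

module RealisingContinuousFunctions (F : Baire → ℕ) (F-cont : PointwiseContinuous F) where

  δ : List ℕ → ℕ
  δ a = F (a ++ₛ 0ω)

  Secure : List ℕ → Set
  Secure a = (b : List ℕ) → δ a ≡ δ (a ++ b)

  RealisableBelow : List ℕ → Set
  RealisableBelow a = KRealisable (λ α → F (a ++ₛ α))

  -- a modulus of continuity at α gives a secure initial segment of α
  secure-cbar : IsCBar Secure
  secure-cbar = secure-bar , δ , λ a → mk⇔ (λ s → s) (λ s → s)
    where
      secure-bar : IsBar Secure
      secure-bar α with F-cont α
      ... | n , near = n , λ b →
        trans (near′ (through-++ₛ (initial α n) 0ω))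
              (sym (near′ (through-prefix _ (initial α n) b (through-++ₛ (initial α n ++ b) 0ω))))
        where
          near′ : ∀ {β} → Through β (initial α n) → F β ≡ F α
          near′ {β} t = near β (through-initial α β n t)

  secure-constant : ∀ a → Secure a → ∀ α → F (a ++ₛ α) ≡ δ a
  secure-constant a secure α with F-cont (a ++ₛ α)
  ... | n , near = trans (sym (near ((a ++ b) ++ₛ 0ω) agree)) (sym (secure b))
    where
      b : List ℕ
      b = initial α n
      n≤ab : n ≤ length (a ++ b)
      n≤ab = subst (_≤ length (a ++ b)) (length-initial α n) (length-≤-++ʳ a b)
      agree : initial ((a ++ b) ++ₛ 0ω) n ≡ initial (a ++ₛ α) n
      agree = initial-shorter _ _ n≤ab
                (trans (through-++ₛ (a ++ b) 0ω) (sym (through-++ₛ-initial a α n)))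

  secure-realisable : ∀ a → Secure a → RealisableBelow a
  secure-realisable a secure =
    realisable-ext _ _ (λ α → sym (secure-constant a secure α)) (realisable-const (δ a))

  -- RealisableBelow is inductive: realisers of the subtrees are glued by cases
  realisable-inductive : Inductive RealisableBelow
  realisable-inductive a ih =
    realisable-ext _ _ (λ α → continuous-ext F F-cont _ _ (++ₛ-shift a α))
      (realisable-cases (λ n β → F ((a ++ [ n ]) ++ₛ β)) ih)

cBI→BC : cBI → BC
cBI→BC cbi F F-cont = cbi Secure RealisableBelow secure-cbar secure-realisable realisable-inductive
  where open RealisingContinuousFunctions F F-cont

module SettlingAlongACBar (P : List ℕ → Set) (P-cbar : IsCBar P) where

  δ : List ℕ → ℕ
  δ = proj₁ (proj₂ P-cbar)

  f : Baire → ℕ → ℕ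
  f α k = δ (initial α k)

  N : Baire → ℕ
  N α = proj₁ (proj₁ P-cbar α)

  F : Baire → ℕ
  F α = settle (f α) (N α)

  stable : ∀ α n → P (initial α n) → Stable (f α) n
  stable α n p k n≤k with initial-extends α k n≤k
  ... | b , αk≡ = trans (cong δ αk≡) (sym (Equivalence.to (proj₂ (proj₂ P-cbar) (initial α n)) p b))

  stable-N : ∀ α → Stable (f α) (N α)
  stable-N α = stable α (N α) (proj₂ (proj₁ P-cbar α))

  -- F is continuous with modulus N: a β agreeing with α up to N α is stable at
  -- N α as well, and settle only inspects values up to N α
  F-continuous : PointwiseContinuous F
  F-continuous α = N α , λ β agree →
    trans (settle-unique (f β) (N β) (N α) (stable-N β)
                         (stable β (N α) (subst P (sym agree) (proj₂ (proj₁ P-cbar α)))))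
          (settle-local (f β) (f α) (N α) (λ k k≤N → cong δ (initial-shorter β α k≤N agree)))

  δ-settled : ∀ α d → Through α d → F α ≤ length d → δ d ≡ f α (N α)
  δ-settled α d t F≤d = trans (cong δ (sym t)) (settle-modulus (f α) (N α) (stable-N α) (length d) F≤d)

  constant-secures : ∀ c v → (∀ α → Through α c → F α ≡ v) → ∀ b → v ≤ length b → P (c ++ b)
  constant-secures c v const b v≤b =
    Equivalence.from (proj₂ (proj₂ P-cbar) (c ++ b)) λ e →
      let d   = c ++ b
          α   = (d ++ e) ++ₛ 0ω
          tde = through-++ₛ (d ++ e) 0ω
          td  = through-prefix α d e tde
          F≤d = subst (_≤ length d) (sym (const α (through-prefix α c b td)))
                      (≤-trans v≤b (length-≤-++ʳ c b))
      in trans (δ-settled α d td F≤d)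
               (sym (δ-settled α (d ++ e) tde (≤-trans F≤d (length-≤-++ˡ d e))))

  firing-secures : ∀ Q → (∀ a → P a → Q a) → Inductive Q
                 → ∀ γ → Realises γ F → ∀ c → γ c > 0 → Q c
  firing-secures Q P⊆Q Q-ind γ real c fires =
    subst Q (++-identityʳ c)
      (inductive-eventually (λ b → P (c ++ b)) (λ b → Q (c ++ b)) (λ b → P⊆Q (c ++ b))
         (inductive-below Q Q-ind c) v (constant-secures c v const))
    where
      v : ℕ
      v = F (c ++ₛ 0ω)
      const : ∀ α → Through α c → F α ≡ v
      const α t = realised-constant-below γ F real c fires α (c ++ₛ 0ω) t (through-++ₛ c 0ω)

BC→cBI : BC → cBI
BC→cBI bc P Q P-cbar P⊆Q Q-ind =
  let γ , γ∈K , real = bc F F-continuous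
  in K-induction Q Q-ind γ∈K (firing-secures Q P⊆Q Q-ind γ real)
  where open SettlingAlongACBar P P-cbar

theorem4p1 : cBI ⇔ BC
theorem4p1 = mk⇔ cBI→BC BC→cBI
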